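{- Let $R$ be a binary relation over the nodes of a $\lambda$-graph. If $R^{\Downarrow}$ is homogeneous, then $R^{\#}=(R^{\Downarrow})^{*}$.
   Context: A $\lambda$-graph is a finite directed graph with application nodes $\mathrm{App}(n_1,n_2)$, abstraction nodes $\mathrm{Abs}(n)$, free variable nodes and bound variable nodes (with a binding edge to an abstraction node), acyclic when binding edges are ignored, with each bound variable node dominated by its binder. Nodes are homogeneous if of the same kind; a relation is homogeneous if it only relates homogeneous nodes. The propagation rules are: $\mathrm{App}(n_1,n_2)\,R\,\mathrm{App}(m_1,m_2)\Rightarrow n_1Rm_1$; $\mathrm{App}(n_1,n_2)\,R\,\mathrm{App}(m_1,m_2)\Rightarrow n_2Rm_2$; $\mathrm{Abs}(n)\,R\,\mathrm{Abs}(m)\Rightarrow nRm$. $R^{\Downarrow}$ is the closure of $R$ under the propagation rules; $R^{*}$ is the reflexive symmetric transitive closure of $R$; $R^{\#}$ is the closure of $R$ under reflexivity, symmetry, transitivity and the propagation rules. -}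

module Defs where

open import Data.Nat using (ℕ)
open import Level using (0ℓ)
open import Data.Fin using (Fin)
open import Data.Product using (∃; _×_; _,_)
open import Data.Empty using (⊥)
open import Data.Unit using (⊤)
open import Relation.Nullary using (¬_)
open import Relation.Binary.Core using (Rel)
open import Relation.Binary.PropositionalEquality using (_≡_)

-- Labels of the nodes of a λ-graph whose nodes are Fin n.
--   app n₁ n₂ : application node App(n₁,n₂)
--   abs n     : abstraction node Abs(n)
--   fvar      : free variable node
--   bvar b    : bound variable node with binding edge to b
data Label (n : ℕ) : Set where
  app  : Fin n → Fin n → Label n
  abs  : Fin n → Label n
  fvar : Label n
  bvar : Fin n → Label n

module _ {n : ℕ} (lab : Fin n → Label n) where

  IsAbs : Fin n → Set
  IsAbs i with lab i
  ... | abs _ = ⊤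
  ... | _     = ⊥

  data Edge : Fin n → Fin n → Set where
    appˡ : ∀ {i a b} → lab i ≡ app a b → Edge i a
    appʳ : ∀ {i a b} → lab i ≡ app a b → Edge i b
    absᵇ : ∀ {i a}   → lab i ≡ abs a   → Edge i a

  data Path⁺ : Fin n → Fin n → Set where
    one  : ∀ {i j}   → Edge i j → Path⁺ i j
    step : ∀ {i j k} → Edge i j → Path⁺ j k → Path⁺ i k

  data Path : Fin n → Fin n → Set where
    here : ∀ {i}     → Path i i
    step : ∀ {i j k} → Edge i j → Path j k → Path i k

  data Visits : ∀ {i j} → Path i j → Fin n → Set where
    at   : ∀ {i j} (p : Path i j) → Visits p i
    later : ∀ {i j k v} (e : Edge i j) {p : Path j k} → Visits p v → Visits (step e p) v

  Root : Fin n → Set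
  Root r = ∀ i → ¬ Edge i r

  Dominates : Fin n → Fin n → Set
  Dominates b v = ∀ r → Root r → (p : Path r v) → Visits p b

  record IsLambdaGraph : Set where
    field
      binderIsAbs : ∀ v b → lab v ≡ bvar b → IsAbs b
      acyclic     : ∀ i → ¬ Path⁺ i i
      dominated   : ∀ v b → lab v ≡ bvar b → Dominates b v

  SameKind : Label n → Label n → Set
  SameKind (app _ _) (app _ _) = ⊤
  SameKind (abs _)   (abs _)   = ⊤
  SameKind fvar      fvar      = ⊤
  SameKind (bvar _)  (bvar _)  = ⊤
  SameKind _         _         = ⊥

  Homogeneous : Rel (Fin n) 0ℓ → Set
  Homogeneous S = ∀ x y → S x y → SameKind (lab x) (lab y)

  module _ (R : Rel (Fin n) 0ℓ) where

    data Down : Rel (Fin n) 0ℓ where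
      base  : ∀ {x y} → R x y → Down x y
      propˡ : ∀ {x y x₁ x₂ y₁ y₂} → lab x ≡ app x₁ x₂ → lab y ≡ app y₁ y₂ →
              Down x y → Down x₁ y₁
      propʳ : ∀ {x y x₁ x₂ y₁ y₂} → lab x ≡ app x₁ x₂ → lab y ≡ app y₁ y₂ →
              Down x y → Down x₂ y₂
      propᵇ : ∀ {x y x₁ y₁} → lab x ≡ abs x₁ → lab y ≡ abs y₁ →
              Down x y → Down x₁ y₁

    data Sharp : Rel (Fin n) 0ℓ where
      base  : ∀ {x y} → R x y → Sharp x y
      refl  : ∀ {x} → Sharp x x
      sym   : ∀ {x y} → Sharp x y → Sharp y x
      trans : ∀ {x y z} → Sharp x y → Sharp y z → Sharp x z
      propˡ : ∀ {x y x₁ x₂ y₁ y₂} → lab x ≡ app x₁ x₂ → lab y ≡ app y₁ y₂ →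
              Sharp x y → Sharp x₁ y₁
      propʳ : ∀ {x y x₁ x₂ y₁ y₂} → lab x ≡ app x₁ x₂ → lab y ≡ app y₁ y₂ →
              Sharp x y → Sharp x₂ y₂
      propᵇ : ∀ {x y x₁ y₁} → lab x ≡ abs x₁ → lab y ≡ abs y₁ →
              Sharp x y → Sharp x₁ y₁

-- If R⇓ is homogeneous, two nodes related by R⇓ carry the same constructor and their
-- children are again related by R⇓.  This "simulation" property survives symmetric and
-- reflexive–transitive closure, so (R⇓)* is already closed under propagation; being an
-- equivalence containing R, it therefore contains R#.
-- Neither direction uses the λ-graph conditions.
module Submission where

open import Defs
open import Data.Nat using (ℕ)
open import Data.Fin using (Fin)
open import Data.Product using (_×_; _,_; proj₁; proj₂)
open import Function using (flip)
open import Level using (0ℓ)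
open import Relation.Binary.Core using (Rel; _⇒_; _⇔_)
open import Relation.Binary.PropositionalEquality using (_≡_; subst₂)
open import Relation.Binary.Construct.Closure.Symmetric using (SymClosure; fwd; bwd)
open import Relation.Binary.Construct.Closure.ReflexiveTransitive using (Star; ε; _◅_; _◅◅_)
open import Relation.Binary.Construct.Closure.Equivalence as Eq using (EqClosure)

module _ {n : ℕ} where

  data Lift (S : Rel (Fin n) 0ℓ) : Rel (Label n) 0ℓ where
    app  : ∀ {x₁ x₂ y₁ y₂} → S x₁ y₁ → S x₂ y₂ → Lift S (app x₁ x₂) (app y₁ y₂)
    abs  : ∀ {x y} → S x y → Lift S (abs x) (abs y)
    fvar : Lift S fvar fvar
    bvar : ∀ {a b} → Lift S (bvar a) (bvar b)

  Lift-map : ∀ {S T} → S ⇒ T → Lift S ⇒ Lift T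
  Lift-map f (app p q) = app (f p) (f q)
  Lift-map f (abs p)   = abs (f p)
  Lift-map f fvar      = fvar
  Lift-map f bvar      = bvar

  Lift-swap : ∀ {S l m} → Lift S l m → Lift (flip S) m l
  Lift-swap (app p q) = app p q
  Lift-swap (abs p)   = abs p
  Lift-swap fvar      = fvar
  Lift-swap bvar      = bvar

  Lift-refl : ∀ {S} (l : Label n) → Lift (Star S) l l
  Lift-refl (app _ _) = app ε ε
  Lift-refl (abs _)   = abs ε
  Lift-refl fvar      = fvar
  Lift-refl (bvar _)  = bvar

  Lift-trans : ∀ {S l m k} → Lift (Star S) l m → Lift (Star S) m k → Lift (Star S) l k
  Lift-trans (app p q) (app p′ q′) = app (p ◅◅ p′) (q ◅◅ q′)
  Lift-trans (abs p)   (abs p′)    = abs (p ◅◅ p′)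
  Lift-trans fvar      fvar        = fvar
  Lift-trans bvar      bvar        = bvar

module _ {n : ℕ} (lab : Fin n → Label n) where

  Simulation : Rel (Fin n) 0ℓ → Set
  Simulation S = ∀ {x y} → S x y → Lift S (lab x) (lab y)

  SymClosure-simulation : ∀ {S} → Simulation S → Simulation (SymClosure S)
  SymClosure-simulation sim (fwd p) = Lift-map fwd (sim p)
  SymClosure-simulation sim (bwd p) = Lift-map bwd (Lift-swap (sim p))

  Star-simulation : ∀ {S} → Simulation S → Simulation (Star S)
  Star-simulation sim ε       = Lift-refl _
  Star-simulation sim (p ◅ c) =
    Lift-trans (Lift-map (_◅ ε) (sim p)) (Star-simulation sim c)

  EqClosure-simulation : ∀ {S} → Simulation S → Simulation (EqClosure S)
  EqClosure-simulation sim = Star-simulation (SymClosure-simulation sim)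

  simulation-app : ∀ {S x y x₁ x₂ y₁ y₂} → Simulation S →
    lab x ≡ app x₁ x₂ → lab y ≡ app y₁ y₂ → S x y → S x₁ y₁ × S x₂ y₂
  simulation-app {S} sim ex ey p with subst₂ (Lift S) ex ey (sim p)
  ... | app p₁ p₂ = p₁ , p₂

  simulation-abs : ∀ {S x y x₁ y₁} → Simulation S →
    lab x ≡ abs x₁ → lab y ≡ abs y₁ → S x y → S x₁ y₁
  simulation-abs {S} sim ex ey p with subst₂ (Lift S) ex ey (sim p)
  ... | abs p₁ = p₁

  module _ (R : Rel (Fin n) 0ℓ) where

    homogeneous-Down-simulation : Homogeneous lab (Down lab R) → Simulation (Down lab R)
    homogeneous-Down-simulation hom {x} {y} p
      with lab x in ex | lab y in ey | hom x y p
    ... | app _ _ | app _ _ | _ = app (propˡ ex ey p) (propʳ ex ey p)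
    ... | abs _   | abs _   | _ = abs (propᵇ ex ey p)
    ... | fvar    | fvar    | _ = fvar
    ... | bvar _  | bvar _  | _ = bvar

    Down⊆Sharp : Down lab R ⇒ Sharp lab R
    Down⊆Sharp (base r)        = base r
    Down⊆Sharp (propˡ ex ey p) = propˡ ex ey (Down⊆Sharp p)
    Down⊆Sharp (propʳ ex ey p) = propʳ ex ey (Down⊆Sharp p)
    Down⊆Sharp (propᵇ ex ey p) = propᵇ ex ey (Down⊆Sharp p)

    EqClosure-Down⊆Sharp : EqClosure (Down lab R) ⇒ Sharp lab R
    EqClosure-Down⊆Sharp ε           = refl
    EqClosure-Down⊆Sharp (fwd p ◅ c) = trans (Down⊆Sharp p) (EqClosure-Down⊆Sharp c)
    EqClosure-Down⊆Sharp (bwd p ◅ c) = trans (sym (Down⊆Sharp p)) (EqClosure-Down⊆Sharp c)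

    Sharp⊆EqClosure-Down : Homogeneous lab (Down lab R) → Sharp lab R ⇒ EqClosure (Down lab R)
    Sharp⊆EqClosure-Down hom = go
      where
      sim : Simulation (EqClosure (Down lab R))
      sim = EqClosure-simulation (homogeneous-Down-simulation hom)

      go : Sharp lab R ⇒ EqClosure (Down lab R)
      go (base r)        = Eq.return (base r)
      go refl            = ε
      go (sym p)         = Eq.symmetric _ (go p)
      go (trans p q)     = go p ◅◅ go q
      go (propˡ ex ey p) = proj₁ (simulation-app sim ex ey (go p))
      go (propʳ ex ey p) = proj₂ (simulation-app sim ex ey (go p))
      go (propᵇ ex ey p) = simulation-abs sim ex ey (go p)

mainTheorem11 : (n : ℕ) (lab : Fin n → Label n) → IsLambdaGraph lab →
    (R : Rel (Fin n) 0ℓ) → Homogeneous lab (Down lab R) →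
    Sharp lab R ⇔ EqClosure (Down lab R)
mainTheorem11 n lab _ R hom = Sharp⊆EqClosure-Down lab R hom , EqClosure-Down⊆Sharp lab R
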